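{- Let $G=(V,E)$ be a finite, strongly connected, directed, unweighted graph, and let $d(x,y)$ denote the (hop) distance from $x$ to $y$ in $G$. Let $s\in V$ be any node, let $u\in V$ satisfy $d(s,u)\ge d(s,x)$ for all $x\in V$, and let $v\in V$ satisfy $d(v,s)\ge d(x,s)$ for all $x\in V$. Define $\tilde{\mathit{VD}}_{\mathrm{SC}}:=d(s,u)+d(v,s)+1$. Then $$\mathit{VD}(G)\le \tilde{\mathit{VD}}_{\mathrm{SC}}<2\,\mathit{VD}(G).$$
   Context: The vertex diameter $\mathit{VD}(G)$ of a graph $G$ is the maximum, over all shortest paths in $G$ (between any ordered pair of nodes $x,y$ with $y$ reachable from $x$), of the number of nodes on that shortest path. In an unweighted graph this equals the maximum finite distance plus one. -}

module Defs where

open import Data.Nat using (ℕ; zero; suc; _+_; _≤_)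
open import Data.Fin using (Fin)
open import Data.Product using (Σ; ∃; _×_)
open import Relation.Binary.PropositionalEquality using (_≡_)

Graph : ℕ → Set₁
Graph n = Fin n → Fin n → Set

module _ {n : ℕ} (E : Graph n) where

  data Walk : Fin n → Fin n → Set where
    [_]  : (x : Fin n) → Walk x x
    _∷_  : ∀ {x y z} → E x y → Walk y z → Walk x z

  len : ∀ {x y} → Walk x y → ℕ
  len [ _ ]   = 0
  len (_ ∷ w) = suc (len w)

  nodes : ∀ {x y} → Walk x y → ℕ
  nodes w = suc (len w)

  IsShortest : ∀ {x y} → Walk x y → Set
  IsShortest {x} {y} w = ∀ (w' : Walk x y) → len w ≤ len w'

  IsDist : Fin n → Fin n → ℕ → Set
  IsDist x y k = Σ (Walk x y) λ w → IsShortest w × len w ≡ k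

  StronglyConnected : Set
  StronglyConnected = ∀ x y → Walk x y

  IsVertexDiameter : ℕ → Set
  IsVertexDiameter D =
    (Σ (Fin n) λ x → Σ (Fin n) λ y → Σ (Walk x y) λ w →
        IsShortest w × nodes w ≡ D)
    × (∀ x y (w : Walk x y) → IsShortest w → nodes w ≤ D)

module Submission where

-- Upper bound: a shortest x→y path is no longer than a shortest x→s path followed by a
-- shortest s→y path, i.e. at most d(v,s) + d(s,u) hops.  Lower bound: the shortest
-- paths realising d(s,u) and d(v,s) each have at most VD(G) nodes.
-- Shortest walks need not exist constructively (the arc relation is not decidable),
-- but their existence is not-not provable, which suffices for a decidable goal like ≤.

open import Defs
open import Data.Nat using (ℕ; zero; suc; _+_; _*_; _≤_; _<_; _≤?_; z≤n; s≤s)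
open import Data.Nat.Properties
  using (≤-trans; ≤-pred; ≤-refl; <-≤-trans; ≰⇒>; n<1+n; +-mono-≤; +-assoc; +-comm; +-identityʳ; module ≤-Reasoning)
open import Data.Fin using (Fin)
open import Data.Product using (Σ; _×_; _,_)
open import Relation.Nullary using (¬_)
open import Relation.Nullary.Decidable using (decidable-stable)
open import Relation.Binary.PropositionalEquality using (_≡_; refl; sym; trans; cong; subst)

module _ {n : ℕ} (E : Graph n) where

  ShortestWalk : Fin n → Fin n → Set
  ShortestWalk x y = Σ (Walk E x y) (IsShortest E)

  _++_ : ∀ {x y z} → Walk E x y → Walk E y z → Walk E x z
  [ _ ]   ++ q = q
  (e ∷ p) ++ q = e ∷ (p ++ q)

  len-++ : ∀ {x y z} (p : Walk E x y) (q : Walk E y z) → len E (p ++ q) ≡ len E p + len E q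
  len-++ [ _ ]   q = refl
  len-++ (e ∷ p) q = cong suc (len-++ p q)

  -- Either w is shortest, or a strictly shorter walk exists and we recurse on it.
  ¬¬-shortest-within : ∀ k {x y} (w : Walk E x y) → len E w ≤ k → ¬ ¬ ShortestWalk x y
  ¬¬-shortest-within zero    w len≤0 noShortest =
    noShortest (w , λ w′ → ≤-trans len≤0 z≤n)
  ¬¬-shortest-within (suc k) w len≤k noShortest = noShortest (w , isShortest)
    where
    isShortest : IsShortest E w
    isShortest w′ = decidable-stable (len E w ≤? len E w′) λ w≰w′ →
      ¬¬-shortest-within k w′ (≤-pred (<-≤-trans (≰⇒> w≰w′) len≤k)) noShortest

  ¬¬-shortest : ∀ {x y} → Walk E x y → ¬ ¬ ShortestWalk x y
  ¬¬-shortest w = ¬¬-shortest-within (len E w) w ≤-refl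

  nodes-shortest-via : ∀ {x y s} (w : Walk E x y) → IsShortest E w →
    (p : Walk E x s) (q : Walk E s y) → nodes E w ≤ suc (len E p + len E q)
  nodes-shortest-via w w-shortest p q = s≤s (subst (len E w ≤_) (len-++ p q) (w-shortest (p ++ q)))

  nodes-shortest≤ecc-in+ecc-out : StronglyConnected E → (s : Fin n) (din dout : ℕ) →
    (∀ x dx → IsDist E x s dx → dx ≤ din) →
    (∀ y dy → IsDist E s y dy → dy ≤ dout) →
    ∀ {x y} (w : Walk E x y) → IsShortest E w → nodes E w ≤ suc (din + dout)
  nodes-shortest≤ecc-in+ecc-out sc s din dout ecc-in ecc-out {x} {y} w w-shortest =
    decidable-stable (nodes E w ≤? suc (din + dout)) λ w-too-long →
      ¬¬-shortest (sc x s) λ { (p , p-shortest) →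
      ¬¬-shortest (sc s y) λ { (q , q-shortest) →
      w-too-long (begin
        nodes E w              ≤⟨ nodes-shortest-via w w-shortest p q ⟩
        suc (len E p + len E q) ≤⟨ s≤s (+-mono-≤ (ecc-in x _ (p , p-shortest , refl))
                                                 (ecc-out y _ (q , q-shortest , refl))) ⟩
        suc (din + dout)       ∎) } }
    where open ≤-Reasoning

sum+1<double : ∀ {a b D} → suc a ≤ D → suc b ≤ D → a + b + 1 < 2 * D
sum+1<double {a} {b} {D} a<D b<D = begin-strict
  a + b + 1     ≡⟨ +-assoc a b 1 ⟩
  a + (b + 1)   ≡⟨ cong (a +_) (+-comm b 1) ⟩
  a + suc b     <⟨ n<1+n _ ⟩
  suc a + suc b ≤⟨ +-mono-≤ a<D b<D ⟩
  D + D         ≡⟨ cong (D +_) (sym (+-identityʳ D)) ⟩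
  2 * D         ∎
  where open ≤-Reasoning

lemma2 : (n : ℕ) (E : Graph n) → StronglyConnected E →
    (s u v : Fin n) (du dv : ℕ) →
    IsDist E s u du → (∀ x dx → IsDist E s x dx → dx ≤ du) →
    IsDist E v s dv → (∀ x dx → IsDist E x s dx → dx ≤ dv) →
    (D : ℕ) → IsVertexDiameter E D →
    (D ≤ du + dv + 1) × (du + dv + 1 < 2 * D)
lemma2 n E sc s u v du dv (wu , wu-shortest , refl) ecc-out (wv , wv-shortest , refl) ecc-in D
  ((x , y , w , w-shortest , refl) , diameter-bound) = upper , lower
  where
  upper : nodes E w ≤ len E wu + len E wv + 1
  upper = subst (nodes E w ≤_) (trans (cong suc (+-comm (len E wv) (len E wu))) (+-comm 1 _))
    (nodes-shortest≤ecc-in+ecc-out E sc s _ _ ecc-in ecc-out w w-shortest)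

  lower : len E wu + len E wv + 1 < 2 * nodes E w
  lower = sum+1<double (diameter-bound s u wu wu-shortest) (diameter-bound v s wv wv-shortest)
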